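{- For $k\ge1$, $n\ge0$ and $0\le r\le n$, \[ M_{k,n,r}=\frac{1}{n+1}\sum_{\substack{\lambda\subseteq k^{n+1}\\ |\lambda|=n\\ \ell(\lambda)=r}} m_\lambda(1^{n+1}). \] For $k\ge0$, $n\ge1$ and $1\le r\le n$, \[ C_{k+1,n,r}=\sum_{\substack{\lambda\subseteq k^{n}\\ |\lambda|<n\\ \ell(\lambda)=r-1}}\frac{n-|\lambda|}{n}\,m_\lambda(1^{n}). \]
   Context: A plane tree is a rooted tree with linearly ordered children; the degree of a node is its number of children, and a node is internal if its degree is positive. $M_{k,n,r}$ is the number of plane trees with $n+1$ nodes, exactly $r$ of them internal, in which every node has degree at most $k$. $C_{k,n,r}$ is the number of plane trees with $n+1$ nodes, exactly $r$ of them internal (the root included), in which every non-root node has degree less than $k$. A partition $\lambda\subseteq a^N$ is a sequence $a\ge\lambda_1\ge\cdots\ge\lambda_N\ge0$ of integers; $|\lambda|=\sum_j\lambda_j$; $\ell(\lambda)=\#\{j:\lambda_j>0\}$; $m_\lambda(1^N)=N!/\prod_{i\ge0}m_i!$ with $m_i=\#\{j:\lambda_j=i\}$. -}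

module Defs where

open import Data.Nat using (ℕ; zero; suc; _+_; _*_; _∸_; _≤_; _<_; _/_; NonZero; _!; _≤ᵇ_; _≡ᵇ_; _<ᵇ_)
open import Data.Nat.Properties using (_!≢0; m*n≢0)
open import Data.Bool using (Bool; true; false; _∧_; if_then_else_)
open import Data.List using (List; []; _∷_; length; map; concatMap; upTo)
open import Data.Nat.ListAction using (sum)
open import Data.List.Relation.Unary.All using (All)
open import Data.Vec using (Vec; []; _∷_; toList)
open import Data.Product using (Σ; _×_)
open import Relation.Binary.PropositionalEquality using (_≡_)

-- Plane trees: a node with a linearly ordered list of children.

data Tree : Set where
  node : List Tree → Tree

degree : Tree → ℕ
degree (node ts) = length ts

mutual
  size : Tree → ℕ
  size (node ts) = suc (sizes ts)

  sizes : List Tree → ℕ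
  sizes []       = 0
  sizes (t ∷ ts) = size t + sizes ts

mutual
  internal : Tree → ℕ
  internal (node [])         = 0
  internal (node ts@(_ ∷ _)) = suc (internals ts)

  internals : List Tree → ℕ
  internals []       = 0
  internals (t ∷ ts) = internal t + internals ts

data EveryDeg (P : ℕ → Set) : Tree → Set where
  node : ∀ {ts} → P (length ts) → All (EveryDeg P) ts → EveryDeg P (node ts)

NonRootDeg : (ℕ → Set) → Tree → Set
NonRootDeg P (node ts) = All (EveryDeg P) ts

-- Trees counted by M_{k,n,r}: n+1 nodes, r internal, all degrees ≤ k
MTrees : ℕ → ℕ → ℕ → Set
MTrees k n r = Σ Tree λ t → size t ≡ suc n × internal t ≡ r × EveryDeg (_≤ k) t

-- Trees counted by C_{k,n,r}: n+1 nodes, r internal (root included),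
-- every non-root node of degree < k
CTrees : ℕ → ℕ → ℕ → Set
CTrees k n r = Σ Tree λ t → size t ≡ suc n × internal t ≡ r × NonRootDeg (_< k) t

-- Partitions λ ⊆ a^N as weakly decreasing vectors of length N with entries ≤ a.

boundedVecs : ℕ → (N : ℕ) → List (Vec ℕ N)
boundedVecs a zero    = [] ∷ []
boundedVecs a (suc N) = concatMap (λ x → map (x ∷_) (boundedVecs a N)) (upTo (suc a))

weaklyDecreasing : ∀ {N} → Vec ℕ N → Bool
weaklyDecreasing []                = true
weaklyDecreasing (x ∷ [])          = true
weaklyDecreasing (x ∷ ys@(y ∷ _))  = (y ≤ᵇ x) ∧ weaklyDecreasing ys

partitionsIn : ℕ → (N : ℕ) → List (Vec ℕ N)
partitionsIn a N = Data.List.filterᵇ weaklyDecreasing (boundedVecs a N)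
  where import Data.List

∣_∣ₚ : ∀ {N} → Vec ℕ N → ℕ
∣ λs ∣ₚ = sum (toList λs)

mult : ∀ {N} → ℕ → Vec ℕ N → ℕ
mult i []       = 0
mult i (x ∷ xs) = (if x ≡ᵇ i then 1 else 0) + mult i xs

ℓ : ∀ {N} → Vec ℕ N → ℕ
ℓ []       = 0
ℓ (x ∷ xs) = (if 0 <ᵇ x then 1 else 0) + ℓ xs

prodFact : List ℕ → ℕ
prodFact []       = 1
prodFact (m ∷ ms) = m ! * prodFact ms

prodFact≢0 : ∀ ms → NonZero (prodFact ms)
prodFact≢0 []       = _
prodFact≢0 (m ∷ ms) = m*n≢0 (m !) (prodFact ms) {{m !≢0}} {{prodFact≢0 ms}}

-- m_λ(1^N) = N! / ∏_{i ≥ 0} m_i!.  Every part satisfies λ_j ≤ |λ|, so the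
-- multiplicities m_i with i > |λ| vanish (0! = 1) and the product over
-- i ∈ {0,…,|λ|} equals the full product over i ≥ 0.
mλ : ∀ {N} → Vec ℕ N → ℕ
mλ {N} λs = (N ! / prodFact ms) {{prodFact≢0 ms}}
  where ms = map (λ i → mult i λs) (upTo (suc ∣ λs ∣ₚ))

SumM : ℕ → ℕ → ℕ → ℕ
SumM k n r = sum (map (λ λs → if (∣ λs ∣ₚ ≡ᵇ n) ∧ (ℓ λs ≡ᵇ r) then mλ λs else 0)
                      (partitionsIn k (suc n)))

-- Σ_{λ ⊆ k^n, |λ| < n, ℓ(λ) = r-1} (n - |λ|) · m_λ(1^n)   (i.e. n times the paper's sum)
SumC : ℕ → ℕ → ℕ → ℕ
SumC k n r = sum (map (λ λs → if (∣ λs ∣ₚ <ᵇ n) ∧ (ℓ λs ≡ᵇ (r ∸ 1)) then (n ∸ ∣ λs ∣ₚ) * mλ λs else 0)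
                      (partitionsIn k n))

module Submission where

open import Algebra.Bundles using (CommutativeMonoid)
import Algebra.Properties.CommutativeSemigroup as CommutativeSemigroupProperties
open import Data.Bool using (Bool; true; false; _∧_; if_then_else_; T)
open import Data.Bool.Properties using (T-irrelevant; T-≡; T-∧; ∧-commutativeMonoid)
open import Data.Empty using (⊥-elim)
open import Data.Fin using (Fin; zero; suc)
open import Data.List using (List; []; _∷_; length; lookup; take; drop; map; _++_; concatMap; upTo; applyUpTo; filterᵇ)
open import Data.List.Membership.Propositional using (_∈_)
open import Data.List.Membership.Propositional.Properties using (∈-lookup; ∈-map⁺)
open import Data.List.Properties
  using (≡-dec; ++-assoc; ++-identityʳ; length-++; take++drop≡id; length-take; length-drop; map-++; map-cong; map-∘; map-upTo; map-applyUpTo)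
open import Data.List.Relation.Binary.Permutation.Propositional using (_↭_; ↭-sym)
open import Data.List.Relation.Binary.Permutation.Propositional.Properties using (↭-length; All-resp-↭; map⁺)
open import Data.List.Relation.Unary.All as All using (All; all?; []; _∷_)
import Data.List.Relation.Unary.All.Properties as All
open import Data.List.Relation.Unary.AllPairs using (AllPairs; []; _∷_)
open import Data.List.Relation.Unary.Any as Any using (here; there)
open import Data.List.Relation.Unary.Linked as Linked using (Linked; []; _∷_; linked?)
open import Data.List.Relation.Unary.Linked.Properties using (AllPairs⇒Linked; Linked⇒AllPairs)
open import Data.Nat using (ℕ; zero; suc; _+_; _*_; _∸_; _/_; _≤_; _<_; _≥_; _≡ᵇ_; _<ᵇ_; _≤ᵇ_; z≤n; s≤s; s≤s⁻¹; _!)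
open import Data.Nat.DivMod using (/-congˡ; /-congʳ; m*n/n≡m)
open import Data.Nat.ListAction using (sum)
open import Data.Nat.ListAction.Properties using (sum-++; sum-↭)
open import Data.Nat.Properties
open import Data.Product using (Σ; _,_; _×_; proj₁; proj₂; ∃-syntax)
open import Data.Vec as Vec using (Vec; toList)
open import Data.Vec.Properties using (length-toList)
open import Defs
open import Function using (_∘_; case_of_)
open import Function.Bundles using (_↔_; mk↔ₛ′; _⇔_; mk⇔; Equivalence)
open import Function.Construct.Composition using (_↔-∘_)
open import Relation.Binary.Definitions using (DecidableEquality)
open import Relation.Binary.PropositionalEquality
import Relation.Binary.Construct.Flip.EqAndOrd as Flip
open import Relation.Nullary.Decidable using (Dec; does; yes; no; dec-true; dec-false)
open import Relation.Nullary.Irrelevant using (Irrelevant)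

open import Data.List.Sort.InsertionSort.Base (Flip.decTotalOrder ≤-decTotalOrder) using (insert; sort)
open import Data.List.Sort.InsertionSort.Properties (Flip.decTotalOrder ≤-decTotalOrder) using (insert-↭; sort-↭; sort-↗)
open CommutativeSemigroupProperties +-commutativeSemigroup using () renaming (interchange to +-interchange)
open CommutativeSemigroupProperties *-commutativeSemigroup using () renaming (x∙yz≈y∙xz to *-exchangeˡ)
open CommutativeSemigroupProperties (CommutativeMonoid.commutativeSemigroup ∧-commutativeMonoid)
  using () renaming (x∙yz≈y∙xz to ∧-exchangeˡ)

-- A plane forest is determined by its preorder degree sequence (its
-- Łukasiewicz word).  The trees counted by M are the tree codes of length
-- n + 1 with r nonzero letters, all ≤ k; those counted by C are a root over
-- a forest whose code has length n.  Group the words of length L by the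
-- partition λ formed by their sorted letters: the fiber of λ has m_λ(1^L)
-- elements, and by the cycle lemma exactly m/L of them code a forest of m
-- trees when m + |λ| = L.  The cycle lemma follows by induction on L:
-- splitting off the first letter d turns an (m + 1)-forest code into an
-- (m + d)-forest code.  Summing over λ gives both identities.

𝟙 : Bool → ℕ
𝟙 b = if b then 1 else 0

𝟙-∧ : ∀ a b → 𝟙 (a ∧ b) ≡ 𝟙 a * 𝟙 b
𝟙-∧ true  b = sym (+-identityʳ (𝟙 b))
𝟙-∧ false b = refl

if-then-else-0≡𝟙* : ∀ b x → (if b then x else 0) ≡ 𝟙 b * x
if-then-else-0≡𝟙* true  x = sym (+-identityʳ x)
if-then-else-0≡𝟙* false x = refl

if∧≡𝟙*𝟙* : ∀ a b x → (if a ∧ b then x else 0) ≡ 𝟙 b * (𝟙 a * x)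
if∧≡𝟙*𝟙* a b x = begin
  (if a ∧ b then x else 0)  ≡⟨ if-then-else-0≡𝟙* (a ∧ b) x ⟩
  𝟙 (a ∧ b) * x             ≡⟨ cong (_* x) (trans (𝟙-∧ a b) (*-comm (𝟙 a) (𝟙 b))) ⟩
  𝟙 b * 𝟙 a * x             ≡⟨ *-assoc (𝟙 b) (𝟙 a) x ⟩
  𝟙 b * (𝟙 a * x)           ∎
  where open ≡-Reasoning

∸*≡𝟙<ᵇ* : ∀ n s x → (n ∸ s) * x ≡ 𝟙 (s <ᵇ n) * ((n ∸ s) * x)
∸*≡𝟙<ᵇ* n s x with s <ᵇ n in s<ᵇn
... | true  = sym (+-identityʳ _)
... | false rewrite m≤n⇒m∸n≡0 {n} {s} (≮⇒≥ (λ s<n → subst T s<ᵇn (<⇒<ᵇ s<n))) = refl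

m<ᵇ1+n≡m≤ᵇn : ∀ m n → (m <ᵇ suc n) ≡ (m ≤ᵇ n)
m<ᵇ1+n≡m≤ᵇn zero    n = refl
m<ᵇ1+n≡m≤ᵇn (suc m) n = refl

module _ {A : Set} where

  ∑ : List A → (A → ℕ) → ℕ
  ∑ xs f = sum (map f xs)

  ∑-++ : ∀ xs ys (f : A → ℕ) → ∑ (xs ++ ys) f ≡ ∑ xs f + ∑ ys f
  ∑-++ xs ys f = trans (cong sum (map-++ f xs ys)) (sum-++ (map f xs) (map f ys))

  ∑-cong : ∀ xs {f g : A → ℕ} → (∀ x → f x ≡ g x) → ∑ xs f ≡ ∑ xs g
  ∑-cong xs f≗g = cong sum (map-cong f≗g xs)

  ∑-cong-∈ : ∀ xs {f g : A → ℕ} → (∀ {x} → x ∈ xs → f x ≡ g x) → ∑ xs f ≡ ∑ xs g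
  ∑-cong-∈ []       f≗g = refl
  ∑-cong-∈ (x ∷ xs) f≗g = cong₂ _+_ (f≗g (here refl)) (∑-cong-∈ xs (f≗g ∘ there))

  ∑-zero : ∀ xs → ∑ xs (λ _ → 0) ≡ 0
  ∑-zero []       = refl
  ∑-zero (x ∷ xs) = ∑-zero xs

  ∑-const : ∀ xs c → ∑ xs (λ _ → c) ≡ length xs * c
  ∑-const []       c = refl
  ∑-const (x ∷ xs) c = cong (c +_) (∑-const xs c)

  ∑-+ : ∀ xs (f g : A → ℕ) → ∑ xs (λ x → f x + g x) ≡ ∑ xs f + ∑ xs g
  ∑-+ []       f g = refl
  ∑-+ (x ∷ xs) f g rewrite ∑-+ xs f g = +-interchange (f x) (g x) (∑ xs f) (∑ xs g)

  *-distribˡ-∑ : ∀ c xs (f : A → ℕ) → c * ∑ xs f ≡ ∑ xs (λ x → c * f x)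
  *-distribˡ-∑ c []       f = *-zeroʳ c
  *-distribˡ-∑ c (x ∷ xs) f = trans (*-distribˡ-+ c (f x) (∑ xs f)) (cong (c * f x +_) (*-distribˡ-∑ c xs f))

  ∑-filterᵇ : ∀ (p : A → Bool) xs (f : A → ℕ) → ∑ (filterᵇ p xs) f ≡ ∑ xs (λ x → 𝟙 (p x) * f x)
  ∑-filterᵇ p []       f = refl
  ∑-filterᵇ p (x ∷ xs) f with p x
  ... | true  = cong₂ _+_ (sym (+-identityʳ (f x))) (∑-filterᵇ p xs f)
  ... | false = ∑-filterᵇ p xs f

  length-filterᵇ : ∀ (p : A → Bool) xs → length (filterᵇ p xs) ≡ ∑ xs (𝟙 ∘ p)
  length-filterᵇ p []       = refl
  length-filterᵇ p (x ∷ xs) with p x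
  ... | true  = cong suc (length-filterᵇ p xs)
  ... | false = length-filterᵇ p xs

module _ {A B : Set} where

  ∑-comm : ∀ xs (ys : List B) (f : A → B → ℕ) → ∑ xs (λ x → ∑ ys (f x)) ≡ ∑ ys (λ y → ∑ xs (λ x → f x y))
  ∑-comm []       ys f = sym (∑-zero ys)
  ∑-comm (x ∷ xs) ys f rewrite ∑-comm xs ys f = sym (∑-+ ys (f x) (λ y → ∑ xs (λ x → f x y)))

  ∑-map : ∀ (g : A → B) xs (f : B → ℕ) → ∑ (map g xs) f ≡ ∑ xs (f ∘ g)
  ∑-map g xs f = cong sum (sym (map-∘ xs))

  ∑-concatMap : ∀ (g : A → List B) xs (f : B → ℕ) → ∑ (concatMap g xs) f ≡ ∑ xs (λ x → ∑ (g x) f)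
  ∑-concatMap g []       f = refl
  ∑-concatMap g (x ∷ xs) f = trans (∑-++ (g x) (concatMap g xs) f) (cong (∑ (g x) f +_) (∑-concatMap g xs f))

∑-↭ : ∀ {A : Set} {xs ys : List A} (f : A → ℕ) → xs ↭ ys → ∑ xs f ≡ ∑ ys f
∑-↭ f xs↭ys = sum-↭ (map⁺ f xs↭ys)

∑-upTo-suc : ∀ n (f : ℕ → ℕ) → ∑ (upTo (suc n)) f ≡ f 0 + ∑ (upTo n) (f ∘ suc)
∑-upTo-suc n f = cong (λ xs → f 0 + sum xs) (trans (map-applyUpTo suc f n) (sym (map-upTo (f ∘ suc) n)))

∑-upTo-δ : ∀ n x (g : ℕ → ℕ) → ∑ (upTo n) (λ y → 𝟙 (x ≡ᵇ y) * g y) ≡ 𝟙 (x <ᵇ n) * g x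
∑-upTo-δ zero    x       g = refl
∑-upTo-δ (suc n) zero    g = trans (∑-upTo-suc n (λ y → 𝟙 (0 ≡ᵇ y) * g y)) (trans (cong (g 0 + 0 +_) (∑-zero (upTo n))) (+-identityʳ _))
∑-upTo-δ (suc n) (suc x) g = trans (∑-upTo-suc n (λ y → 𝟙 (suc x ≡ᵇ y) * g y)) (∑-upTo-δ n x (g ∘ suc))

∑-linear : ∀ m xs c → ∑ xs (λ d → (m + d) * c) ≡ (m * length xs + sum xs) * c
∑-linear m []       c = cong (_* c) (sym (trans (+-identityʳ (m * 0)) (*-zeroʳ m)))
∑-linear m (x ∷ xs) c = begin
  (m + x) * c + ∑ xs (λ d → (m + d) * c)     ≡⟨ cong ((m + x) * c +_) (∑-linear m xs c) ⟩
  (m + x) * c + (m * length xs + sum xs) * c ≡⟨ *-distribʳ-+ c (m + x) _ ⟨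
  (m + x + (m * length xs + sum xs)) * c     ≡⟨ cong (_* c) (+-interchange m x (m * length xs) (sum xs)) ⟩
  (m + m * length xs + (x + sum xs)) * c     ≡⟨ cong (λ e → (e + (x + sum xs)) * c) (*-suc m (length xs)) ⟨
  (m * suc (length xs) + (x + sum xs)) * c   ∎
  where open ≡-Reasoning

All-≤-sum : ∀ xs → All (_≤ sum xs) xs
All-≤-sum []       = []
All-≤-sum (x ∷ xs) = m≤m+n x (sum xs) ∷ All.map (λ y≤ → ≤-trans y≤ (m≤n+m (sum xs) x)) (All-≤-sum xs)

prodFact-cong : ∀ n {f g : ℕ → ℕ} → (∀ i → f i ≡ g i) → prodFact (applyUpTo f n) ≡ prodFact (applyUpTo g n)
prodFact-cong zero    f≗g = refl
prodFact-cong (suc n) f≗g = cong₂ (λ a b → a ! * b) (f≗g 0) (prodFact-cong n (f≗g ∘ suc))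

prodFact-bump : ∀ n d (f g : ℕ → ℕ) → d < n → f d ≡ suc (g d) → (∀ i → i ≢ d → f i ≡ g i) →
                prodFact (applyUpTo f n) ≡ f d * prodFact (applyUpTo g n)
prodFact-bump (suc n) zero f g _ fd≡ f≗g rewrite fd≡ =
  trans (*-assoc (suc (g 0)) (g 0 !) _) (cong (λ p → suc (g 0) * (g 0 ! * p)) (prodFact-cong n (λ i → f≗g (suc i) λ ())))
prodFact-bump (suc n) (suc d) f g (s≤s d<n) fd≡ f≗g =
  trans (cong₂ _*_ (cong _! (f≗g 0 λ ())) (prodFact-bump n d (f ∘ suc) (g ∘ suc) d<n fd≡ (λ i i≢d → f≗g (suc i) (i≢d ∘ suc-injective))))
        (*-exchangeˡ (g 0 !) (f (suc d)) _)

T-does⇔ : ∀ {P : Set} (p? : Dec P) → T (does p?) ⇔ P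
T-does⇔ (yes p) = mk⇔ (λ _ → p) (λ _ → _)
T-does⇔ (no ¬p) = mk⇔ (λ ()) ¬p

∧-intro : ∀ {a b} → T a → T b → T (a ∧ b)
∧-intro ta tb = Equivalence.from T-∧ (ta , tb)

∧-elim : ∀ {a b} → T (a ∧ b) → T a × T b
∧-elim = Equivalence.to T-∧

T-≡ᵇ⇔ : ∀ {m n} → T (m ≡ᵇ n) ⇔ m ≡ n
T-≡ᵇ⇔ {m} {n} = T-does⇔ (m ≟ n)

≡ᵇ-refl : ∀ n → (n ≡ᵇ n) ≡ true
≡ᵇ-refl n = dec-true (n ≟ n) refl

Σ-≡ : ∀ {A : Set} {P : A → Set} → (∀ {a} → Irrelevant (P a)) → ∀ {a b} {p : P a} {q : P b} → a ≡ b → (a , p) ≡ (b , q)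
Σ-≡ P-irrelevant {p = p} {q} refl = cong (_ ,_) (P-irrelevant p q)

×-irrelevant : ∀ {A B : Set} → Irrelevant A → Irrelevant B → Irrelevant (A × B)
×-irrelevant A-irr B-irr (a , b) (a′ , b′) = cong₂ _,_ (A-irr a a′) (B-irr b b′)

Σ-↔ : ∀ {A B : Set} {P : A → Set} {Q : B → Set} →
      (∀ {a} → Irrelevant (P a)) → (∀ {b} → Irrelevant (Q b)) →
      (f : A → B) (g : B → A) → (∀ a → g (f a) ≡ a) → (∀ {b} → Q b → f (g b) ≡ b) →
      (∀ a → P a ⇔ Q (f a)) → Σ A P ↔ Σ B Q
Σ-↔ {Q = Q} P-irr Q-irr f g g∘f f∘g P⇔Q = mk↔ₛ′ to from (λ (b , q) → Σ-≡ Q-irr (f∘g q)) (λ (a , p) → Σ-≡ P-irr (g∘f a))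
  where
  to = λ (a , p) → f a , Equivalence.to (P⇔Q a) p
  from = λ (b , q) → g b , Equivalence.from (P⇔Q (g b)) (subst Q (sym (f∘g q)) q)

module _ {A : Set} (_≟_ : DecidableEquality A) where

  occurrences : A → List A → ℕ
  occurrences x xs = ∑ xs (λ y → 𝟙 (does (x ≟ y)))

  occurrences-here : ∀ x xs → occurrences x (x ∷ xs) ≡ suc (occurrences x xs)
  occurrences-here x xs rewrite dec-true (x ≟ x) refl = refl

  ∈⇒occurrences-pos : ∀ {x xs} → x ∈ xs → 0 < occurrences x xs
  ∈⇒occurrences-pos {x} {_ ∷ xs} (here refl) = subst (0 <_) (sym (occurrences-here x xs)) (s≤s z≤n)
  ∈⇒occurrences-pos (there x∈xs) = ≤-trans (∈⇒occurrences-pos x∈xs) (m≤n+m _ _)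

  occurrences-filterᵇ : ∀ x (p : A → Bool) xs → occurrences x (filterᵇ p xs) ≡ 𝟙 (p x) * occurrences x xs
  occurrences-filterᵇ x p xs = begin
    ∑ (filterᵇ p xs) (λ y → 𝟙 (does (x ≟ y)))         ≡⟨ ∑-filterᵇ p xs _ ⟩
    ∑ xs (λ y → 𝟙 (p y) * 𝟙 (does (x ≟ y)))          ≡⟨ ∑-cong xs pointwise ⟩
    ∑ xs (λ y → 𝟙 (p x) * 𝟙 (does (x ≟ y)))          ≡⟨ *-distribˡ-∑ (𝟙 (p x)) xs _ ⟨
    𝟙 (p x) * occurrences x xs                       ∎
    where
    open ≡-Reasoning
    pointwise : ∀ y → 𝟙 (p y) * 𝟙 (does (x ≟ y)) ≡ 𝟙 (p x) * 𝟙 (does (x ≟ y))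
    pointwise y with x ≟ y
    ... | yes refl = refl
    ... | no _     = trans (*-zeroʳ (𝟙 (p y))) (sym (*-zeroʳ (𝟙 (p x))))

  Enumerates : (A → Bool) → List A → Set
  Enumerates q xs = ∀ x → occurrences x xs ≡ 𝟙 (q x)

  module _ {q : A → Bool} {xs : List A} (enum : Enumerates q xs) where

    private
      locate : ∀ x ys → 0 < occurrences x ys → Fin (length ys)
      locate x (y ∷ ys) occ with x ≟ y
      ... | yes _ = zero
      ... | no  _ = suc (locate x ys occ)

      lookup-locate : ∀ x ys occ → lookup ys (locate x ys occ) ≡ x
      lookup-locate x (y ∷ ys) occ with x ≟ y
      ... | yes x≡y = sym x≡y
      ... | no  _   = lookup-locate x ys occ

      locate-lookup : ∀ ys → (∀ x → occurrences x ys ≤ 1) → ∀ i occ → locate (lookup ys i) ys occ ≡ i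
      locate-lookup (y ∷ ys) once zero occ with y ≟ y
      ... | yes _   = refl
      ... | no  y≢y = ⊥-elim (y≢y refl)
      locate-lookup (y ∷ ys) once (suc i) occ with lookup ys i ≟ y
      ... | yes refl = ⊥-elim (<-irrefl refl (begin-strict
        1                                     <⟨ s≤s (∈⇒occurrences-pos (∈-lookup {xs = ys} i)) ⟩
        suc (occurrences (lookup ys i) ys)    ≡⟨ occurrences-here (lookup ys i) ys ⟨
        occurrences (lookup ys i) (y ∷ ys)    ≤⟨ once (lookup ys i) ⟩
        1                                     ∎))
        where open ≤-Reasoning
      ... | no  _    = cong suc (locate-lookup ys (λ x → ≤-trans (m≤n+m _ _) (once x)) i occ)

      occurs⇒q : ∀ x → 0 < occurrences x xs → T (q x)
      occurs⇒q x occ with q x | enum x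
      ... | true  | _   = _
      ... | false | o≡0 = ⊥-elim (<-irrefl (sym o≡0) occ)

      q⇒occurs : ∀ x → T (q x) → 0 < occurrences x xs
      q⇒occurs x qx with q x | enum x
      ... | true | o≡1 = ≤-reflexive (sym o≡1)

      occurs-once : ∀ x → occurrences x xs ≤ 1
      occurs-once x with q x | enum x
      ... | true  | o≡1 = ≤-reflexive o≡1
      ... | false | o≡0 = ≤-trans (≤-reflexive o≡0) z≤n

    Enumerates⇒↔Fin : Σ A (T ∘ q) ↔ Fin (length xs)
    Enumerates⇒↔Fin = mk↔ₛ′ to from to∘from from∘to
      where
      to : Σ A (T ∘ q) → Fin (length xs)
      to (x , qx) = locate x xs (q⇒occurs x qx)
      from : Fin (length xs) → Σ A (T ∘ q)
      from i = lookup xs i , occurs⇒q _ (∈⇒occurrences-pos (∈-lookup {xs = xs} i))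
      to∘from : ∀ i → to (from i) ≡ i
      to∘from i = locate-lookup xs occurs-once i _
      from∘to : ∀ y → from (to y) ≡ y
      from∘to (x , qx) = Σ-≡ T-irrelevant (lookup-locate x xs _)

_≟ᴸ_ : DecidableEquality (List ℕ)
_≟ᴸ_ = ≡-dec _≟_

bounded : ℕ → List ℕ → Bool
bounded k w = does (all? (_≤? k) w)

T-bounded⇔ : ∀ {k w} → T (bounded k w) ⇔ All (_≤ k) w
T-bounded⇔ {k} {w} = T-does⇔ (all? (_≤? k) w)

bounded-↭ : ∀ k {xs ys} → xs ↭ ys → bounded k xs ≡ bounded k ys
bounded-↭ k {xs} {ys} xs↭ys with all? (_≤? k) xs | all? (_≤? k) ys
... | yes _   | yes _   = refl
... | no  ¬xs | yes ys≤ = ⊥-elim (¬xs (All-resp-↭ (↭-sym xs↭ys) ys≤))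
... | yes xs≤ | no  ¬ys = ⊥-elim (¬ys (All-resp-↭ xs↭ys xs≤))
... | no  _   | no  _   = refl

words : ℕ → ℕ → List (List ℕ)
words k L = map toList (boundedVecs k L)

module _ (k : ℕ) where

  ∑-words-suc : ∀ L (f : List ℕ → ℕ) → ∑ (words k (suc L)) f ≡ ∑ (upTo (suc k)) (λ d → ∑ (words k L) (λ w → f (d ∷ w)))
  ∑-words-suc L f = begin
    ∑ (words k (suc L)) f
      ≡⟨ ∑-map toList (concatMap (λ d → map (d Vec.∷_) (boundedVecs k L)) (upTo (suc k))) f ⟩
    ∑ (concatMap (λ d → map (d Vec.∷_) (boundedVecs k L)) (upTo (suc k))) (f ∘ toList)
      ≡⟨ ∑-concatMap (λ d → map (d Vec.∷_) (boundedVecs k L)) (upTo (suc k)) (f ∘ toList) ⟩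
    ∑ (upTo (suc k)) (λ d → ∑ (map (d Vec.∷_) (boundedVecs k L)) (f ∘ toList))
      ≡⟨ ∑-cong (upTo (suc k)) (λ d → trans (∑-map (d Vec.∷_) (boundedVecs k L) (f ∘ toList))
                                            (sym (∑-map toList (boundedVecs k L) (λ w → f (d ∷ w))))) ⟩
    ∑ (upTo (suc k)) (λ d → ∑ (words k L) (λ w → f (d ∷ w)))  ∎
    where open ≡-Reasoning

  occurrences-words : ∀ L v → occurrences _≟ᴸ_ v (words k L) ≡ 𝟙 ((length v ≡ᵇ L) ∧ bounded k v)
  occurrences-words zero    []      = refl
  occurrences-words zero    (_ ∷ _) = refl
  occurrences-words (suc L) []      = trans (∑-words-suc L _) (trans (∑-cong (upTo (suc k)) (λ _ → ∑-zero (words k L))) (∑-zero (upTo (suc k))))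
  occurrences-words (suc L) (x ∷ v) = begin
    occurrences _≟ᴸ_ (x ∷ v) (words k (suc L))
      ≡⟨ ∑-words-suc L _ ⟩
    ∑ (upTo (suc k)) (λ d → ∑ (words k L) (λ w → 𝟙 ((x ≡ᵇ d) ∧ does (v ≟ᴸ w))))
      ≡⟨ ∑-cong (upTo (suc k)) (λ d → trans (∑-cong (words k L) (λ w → 𝟙-∧ (x ≡ᵇ d) (does (v ≟ᴸ w))))
                                            (sym (*-distribˡ-∑ (𝟙 (x ≡ᵇ d)) (words k L) _))) ⟩
    ∑ (upTo (suc k)) (λ d → 𝟙 (x ≡ᵇ d) * occurrences _≟ᴸ_ v (words k L))
      ≡⟨ ∑-upTo-δ (suc k) x _ ⟩
    𝟙 (x <ᵇ suc k) * occurrences _≟ᴸ_ v (words k L)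
      ≡⟨ cong (λ b → 𝟙 b * occurrences _≟ᴸ_ v (words k L)) (m<ᵇ1+n≡m≤ᵇn x k) ⟩
    𝟙 (x ≤ᵇ k) * occurrences _≟ᴸ_ v (words k L)
      ≡⟨ cong (𝟙 (x ≤ᵇ k) *_) (occurrences-words L v) ⟩
    𝟙 (x ≤ᵇ k) * 𝟙 ((length v ≡ᵇ L) ∧ bounded k v)
      ≡⟨ 𝟙-∧ (x ≤ᵇ k) _ ⟨
    𝟙 ((x ≤ᵇ k) ∧ ((length v ≡ᵇ L) ∧ bounded k v))
      ≡⟨ cong 𝟙 (∧-exchangeˡ (x ≤ᵇ k) (length v ≡ᵇ L) (bounded k v)) ⟩
    𝟙 ((length v ≡ᵇ L) ∧ ((x ≤ᵇ k) ∧ bounded k v))  ∎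
    where open ≡-Reasoning

  Enumerates-filter-words : ∀ L (p : List ℕ → Bool) →
    Enumerates _≟ᴸ_ (λ v → p v ∧ ((length v ≡ᵇ L) ∧ bounded k v)) (filterᵇ p (words k L))
  Enumerates-filter-words L p v = trans (occurrences-filterᵇ _≟ᴸ_ v p (words k L))
    (trans (cong (𝟙 (p v) *_) (occurrences-words L v)) (sym (𝟙-∧ (p v) _)))

-- Weakly decreasing lists as multisets

Decreasing : List ℕ → Set
Decreasing = Linked _≥_

Decreasing⇒AllPairs : ∀ {λs} → Decreasing λs → AllPairs _≥_ λs
Decreasing⇒AllPairs = Linked⇒AllPairs (λ x≥y y≥z → ≤-trans y≥z x≥y)

decreasing? : List ℕ → Bool
decreasing? λs = does (linked? _≥?_ λs)

remove : ℕ → List ℕ → List ℕ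
remove d []       = []
remove d (y ∷ ys) = if d ≡ᵇ y then ys else y ∷ remove d ys

All-remove : ∀ {P : ℕ → Set} d {xs} → All P xs → All P (remove d xs)
All-remove d         []                = []
All-remove d {y ∷ _} (py ∷ pys) with d ≡ᵇ y
... | true  = pys
... | false = py ∷ All-remove d pys

remove-decreasing : ∀ d {λs} → Decreasing λs → Decreasing (remove d λs)
remove-decreasing d = AllPairs⇒Linked ∘ go ∘ Decreasing⇒AllPairs
  where
  go : ∀ {xs} → AllPairs _≥_ xs → AllPairs _≥_ (remove d xs)
  go                []           = []
  go {y ∷ _} (y≥ys ∷ ys) with d ≡ᵇ y
  ... | true  = ys
  ... | false = All-remove d y≥ys ∷ go ys

remove-here : ∀ d ys → remove d (d ∷ ys) ≡ ys
remove-here d ys rewrite ≡ᵇ-refl d = refl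

remove-≢ : ∀ {d y} ys → d ≢ y → remove d (y ∷ ys) ≡ y ∷ remove d ys
remove-≢ {d} {y} ys d≢y rewrite dec-false (d ≟ y) d≢y = refl

insert-< : ∀ {d y} ys → d < y → insert d (y ∷ ys) ≡ y ∷ insert d ys
insert-< {d} {y} ys d<y rewrite dec-false (y ≤? d) (<⇒≱ d<y) = refl

insert-head : ∀ d ys → Decreasing (d ∷ ys) → insert d ys ≡ d ∷ ys
insert-head d []       _         = refl
insert-head d (z ∷ zs) (d≥z ∷ _) rewrite dec-true (z ≤? d) d≥z = refl

remove-insert : ∀ d μ → remove d (insert d μ) ≡ μ
remove-insert d []       = remove-here d []
remove-insert d (y ∷ ys) with y ≤ᵇ d in y≤ᵇd
... | true  = remove-here d (y ∷ ys)
... | false = trans (remove-≢ (insert d ys) (λ { refl → subst T y≤ᵇd (≤⇒≤ᵇ (≤-refl {d})) })) (cong (y ∷_) (remove-insert d ys))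

insert-remove : ∀ d {λs} → Decreasing λs → d ∈ λs → insert d (remove d λs) ≡ λs
insert-remove d {y ∷ ys} dec d∈ with d ≟ y
... | yes refl = trans (cong (insert d) (remove-here d ys)) (insert-head d ys dec)
... | no  d≢y  = begin
  insert d (remove d (y ∷ ys))  ≡⟨ cong (insert d) (remove-≢ ys d≢y) ⟩
  insert d (y ∷ remove d ys)    ≡⟨ insert-< (remove d ys) d<y ⟩
  y ∷ insert d (remove d ys)    ≡⟨ cong (y ∷_) (insert-remove d (Linked.tail dec) d∈ys) ⟩
  y ∷ ys                        ∎
  where
  open ≡-Reasoning
  d∈ys : d ∈ ys
  d∈ys = Any.tail d≢y d∈
  d<y : d < y
  d<y with Decreasing⇒AllPairs dec
  ... | y≥ys ∷ _ = ≤∧≢⇒< (All.lookup y≥ys d∈ys) d≢y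

∑-insert : ∀ d μ (f : ℕ → ℕ) → ∑ (insert d μ) f ≡ f d + ∑ μ f
∑-insert d μ f = ∑-↭ f (insert-↭ d μ)

∑-remove : ∀ d {λs} → Decreasing λs → d ∈ λs → ∀ f → ∑ λs f ≡ f d + ∑ (remove d λs) f
∑-remove d {λs} dec d∈ f = trans (cong (λ xs → ∑ xs f) (sym (insert-remove d dec d∈))) (∑-insert d (remove d λs) f)

length-remove : ∀ d {λs} → Decreasing λs → d ∈ λs → length λs ≡ suc (length (remove d λs))
length-remove d {λs} dec d∈ = trans (cong length (sym (insert-remove d dec d∈))) (↭-length (insert-↭ d (remove d λs)))

sum-remove : ∀ d {λs} → Decreasing λs → d ∈ λs → sum λs ≡ d + sum (remove d λs)
sum-remove d {λs} dec d∈ = trans (cong sum (sym (insert-remove d dec d∈))) (sum-↭ (insert-↭ d (remove d λs)))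

multiplicity : ℕ → List ℕ → ℕ
multiplicity i λs = ∑ λs (λ x → 𝟙 (x ≡ᵇ i))

_∈ᵇ_ : ℕ → List ℕ → Bool
d ∈ᵇ λs = 0 <ᵇ multiplicity d λs

∈ᵇ⇒∈ : ∀ d λs → T (d ∈ᵇ λs) → d ∈ λs
∈ᵇ⇒∈ d (x ∷ xs) d∈ with x ≡ᵇ d in x≡ᵇd
... | true  = here (sym (≡ᵇ⇒≡ x d (subst T (sym x≡ᵇd) _)))
... | false = there (∈ᵇ⇒∈ d xs d∈)

∈ᵇ-insert : ∀ d μ → T (d ∈ᵇ insert d μ)
∈ᵇ-insert d μ = subst (T ∘ (0 <ᵇ_)) (sym (trans (∑-insert d μ _) (cong (λ b → 𝟙 b + multiplicity d μ) (≡ᵇ-refl d)))) _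

∉ᵇ⇒multiplicity≡0 : ∀ d λs → d ∈ᵇ λs ≡ false → multiplicity d λs ≡ 0
∉ᵇ⇒multiplicity≡0 d λs d∉ with multiplicity d λs
... | zero  = refl
... | suc _ = case d∉ of λ ()

does-insert≟ : ∀ d μ {λs} → Decreasing λs → does (insert d μ ≟ᴸ λs) ≡ (d ∈ᵇ λs) ∧ does (μ ≟ᴸ remove d λs)
does-insert≟ d μ {λs} dec with insert d μ ≟ᴸ λs
... | yes refl = sym (trans (cong₂ _∧_ (Equivalence.to T-≡ (∈ᵇ-insert d μ)) (cong (does ∘ (μ ≟ᴸ_)) (remove-insert d μ)))
                           (dec-true (μ ≟ᴸ μ) refl))
... | no ins≢ with d ∈ᵇ λs in d∈ᵇ
...   | false = refl
...   | true  = sym (dec-false (μ ≟ᴸ remove d λs) λ μ≡ →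
                  ins≢ (trans (cong (insert d) μ≡) (insert-remove d dec (∈ᵇ⇒∈ d λs (subst T (sym d∈ᵇ) _)))))

multiplicity-remove : ∀ d {λs} → Decreasing λs → d ∈ λs → ∀ i → multiplicity i λs ≡ 𝟙 (d ≡ᵇ i) + multiplicity i (remove d λs)
multiplicity-remove d dec d∈ i = ∑-remove d dec d∈ (λ x → 𝟙 (x ≡ᵇ i))

prodFactMult : ℕ → List ℕ → ℕ
prodFactMult b λs = prodFact (applyUpTo (λ i → multiplicity i λs) b)

prodFactMult-[] : ∀ b → prodFactMult b [] ≡ 1
prodFactMult-[] zero    = refl
prodFactMult-[] (suc b) = trans (+-identityʳ _) (prodFactMult-[] b)

prodFactMult-remove : ∀ b d {λs} → Decreasing λs → d ∈ λs → d < b →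
                      prodFactMult b λs ≡ multiplicity d λs * prodFactMult b (remove d λs)
prodFactMult-remove b d {λs} dec d∈ d<b = prodFact-bump b d _ _ d<b
  (trans (multiplicity-remove d dec d∈ d) (cong (λ e → 𝟙 e + multiplicity d (remove d λs)) (≡ᵇ-refl d)))
  (λ i i≢d → trans (multiplicity-remove d dec d∈ i)
                   (cong (λ e → 𝟙 e + multiplicity i (remove d λs)) (dec-false (d ≟ i) (i≢d ∘ sym))))

-- Łukasiewicz codes of plane forests

nonzeros : List ℕ → ℕ
nonzeros w = ∑ w (λ x → 𝟙 (0 <ᵇ x))

code : Tree → List ℕ
codes : List Tree → List ℕ
code (node ts) = length ts ∷ codes ts
codes []       = []
codes (t ∷ ts) = code t ++ codes ts

decode : List ℕ → List Tree
decode []      = []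
decode (d ∷ w) = node (take d (decode w)) ∷ drop d (decode w)

-- w codes a forest of m trees: the walk starting at height m that moves
-- by d − 1 at each letter d first reaches height 0 at the end of w.
codesForest : ℕ → List ℕ → Bool
codesForest zero    []      = true
codesForest zero    (_ ∷ _) = false
codesForest (suc m) []      = false
codesForest (suc m) (d ∷ w) = codesForest (m + d) w

take-++ : ∀ {A : Set} (xs ys : List A) → take (length xs) (xs ++ ys) ≡ xs
take-++ []       ys = refl
take-++ (x ∷ xs) ys = cong (x ∷_) (take-++ xs ys)

drop-++ : ∀ {A : Set} (xs ys : List A) → drop (length xs) (xs ++ ys) ≡ ys
drop-++ []       ys = refl
drop-++ (x ∷ xs) ys = drop-++ xs ys

decode-code : ∀ t w → decode (code t ++ w) ≡ t ∷ decode w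
decode-codes : ∀ ts w → decode (codes ts ++ w) ≡ ts ++ decode w
decode-code (node ts) w rewrite decode-codes ts w | take-++ ts (decode w) | drop-++ ts (decode w) = refl
decode-codes []       w = refl
decode-codes (t ∷ ts) w rewrite ++-assoc (code t) (codes ts) w | decode-code t (codes ts ++ w) | decode-codes ts w = refl

codesForest-code : ∀ t m w → codesForest (suc m) (code t ++ w) ≡ codesForest m w
codesForest-codes : ∀ ts m w → codesForest (length ts + m) (codes ts ++ w) ≡ codesForest m w
codesForest-code (node ts) m w rewrite +-comm m (length ts) = codesForest-codes ts m w
codesForest-codes []       m w = refl
codesForest-codes (t ∷ ts) m w rewrite ++-assoc (code t) (codes ts) w
  | codesForest-code t (length ts + m) (codes ts ++ w) = codesForest-codes ts m w

codes-++ : ∀ ts us → codes (ts ++ us) ≡ codes ts ++ codes us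
codes-++ []       us = refl
codes-++ (t ∷ ts) us rewrite codes-++ ts us = sym (++-assoc (code t) (codes ts) (codes us))

codesForest⇒decode : ∀ m w → T (codesForest m w) → length (decode w) ≡ m × codes (decode w) ≡ w
codesForest⇒decode zero    []      _  = refl , refl
codesForest⇒decode (suc m) (d ∷ w) cf with decode w | codesForest⇒decode (m + d) w cf
... | ts | len≡ , codes≡ = cong suc len-drop , codes-node
  where
  len-take : length (take d ts) ≡ d
  len-take = trans (length-take d ts) (m≤n⇒m⊓n≡m (subst (d ≤_) (sym len≡) (m≤n+m d m)))
  len-drop : length (drop d ts) ≡ m
  len-drop = trans (length-drop d ts) (trans (cong (_∸ d) len≡) (m+n∸n≡m m d))
  codes-node : (length (take d ts) ∷ codes (take d ts)) ++ codes (drop d ts) ≡ d ∷ w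
  codes-node = cong₂ _∷_ len-take (begin
    codes (take d ts) ++ codes (drop d ts)  ≡⟨ codes-++ (take d ts) (drop d ts) ⟨
    codes (take d ts ++ drop d ts)          ≡⟨ cong codes (take++drop≡id d ts) ⟩
    codes ts                                ≡⟨ codes≡ ⟩
    w                                       ∎)
    where open ≡-Reasoning

codesForest-sum : ∀ m w → T (codesForest m w) → m + sum w ≡ length w
codesForest-sum zero    []      _  = refl
codesForest-sum (suc m) (d ∷ w) cf = cong suc (trans (sym (+-assoc m d (sum w))) (codesForest-sum (m + d) w cf))

length-code : ∀ t → length (code t) ≡ size t
length-codes : ∀ ts → length (codes ts) ≡ sizes ts
length-code (node ts) = cong suc (length-codes ts)
length-codes []       = refl
length-codes (t ∷ ts) = trans (length-++ (code t)) (cong₂ _+_ (length-code t) (length-codes ts))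

nonzeros-code : ∀ t → nonzeros (code t) ≡ internal t
nonzeros-codes : ∀ ts → nonzeros (codes ts) ≡ internals ts
nonzeros-code (node [])       = nonzeros-codes []
nonzeros-code (node (t ∷ ts)) = cong suc (nonzeros-codes (t ∷ ts))
nonzeros-codes []       = refl
nonzeros-codes (t ∷ ts) = trans (∑-++ (code t) (codes ts) _) (cong₂ _+_ (nonzeros-code t) (nonzeros-codes ts))

module _ {P : ℕ → Set} where

  EveryDeg⇒All-code : ∀ {t} → EveryDeg P t → All P (code t)
  AllEveryDeg⇒All-codes : ∀ {ts} → All (EveryDeg P) ts → All P (codes ts)
  EveryDeg⇒All-code (node p ps) = p ∷ AllEveryDeg⇒All-codes ps
  AllEveryDeg⇒All-codes []       = []
  AllEveryDeg⇒All-codes (p ∷ ps) = All.++⁺ (EveryDeg⇒All-code p) (AllEveryDeg⇒All-codes ps)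

  All-code⇒EveryDeg : ∀ t → All P (code t) → EveryDeg P t
  All-codes⇒AllEveryDeg : ∀ ts → All P (codes ts) → All (EveryDeg P) ts
  All-code⇒EveryDeg (node ts) (p ∷ ps) = node p (All-codes⇒AllEveryDeg ts ps)
  All-codes⇒AllEveryDeg []       _  = []
  All-codes⇒AllEveryDeg (t ∷ ts) ps = All-code⇒EveryDeg t (All.++⁻ˡ (code t) ps) ∷ All-codes⇒AllEveryDeg ts (All.++⁻ʳ (code t) ps)

  module _ (P-irrelevant : ∀ {d} → Irrelevant (P d)) where

    EveryDeg-irrelevant : ∀ {t} → Irrelevant (EveryDeg P t)
    AllEveryDeg-irrelevant : ∀ {ts} → Irrelevant (All (EveryDeg P) ts)
    EveryDeg-irrelevant (node p ps) (node q qs) = cong₂ node (P-irrelevant p q) (AllEveryDeg-irrelevant ps qs)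
    AllEveryDeg-irrelevant []       []       = refl
    AllEveryDeg-irrelevant (p ∷ ps) (q ∷ qs) = cong₂ _∷_ (EveryDeg-irrelevant p q) (AllEveryDeg-irrelevant ps qs)

decode-codes-[] : ∀ ts → decode (codes ts) ≡ ts
decode-codes-[] ts = trans (cong decode (sym (++-identityʳ (codes ts)))) (trans (decode-codes ts []) (++-identityʳ ts))

codesForest-length-codes : ∀ ts → T (codesForest (length ts) (codes ts))
codesForest-length-codes ts = subst T (sym (trans (cong₂ codesForest (sym (+-identityʳ (length ts))) (sym (++-identityʳ (codes ts))))
                                                   (codesForest-codes ts 0 []))) _

decodeTree : List ℕ → Tree
decodeTree w with decode w
... | t ∷ _ = t
... | []    = node []

decodeTree-code : ∀ t → decodeTree (code t) ≡ t
decodeTree-code t rewrite trans (cong decode (sym (++-identityʳ (code t)))) (decode-code t []) = refl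

code-decodeTree : ∀ {w} → T (codesForest 1 w) → code (decodeTree w) ≡ w
code-decodeTree {w} cf with decode w | codesForest⇒decode 1 w cf
... | t ∷ [] | _ , codes≡ = trans (sym (++-identityʳ (code t))) codes≡

codesForest-1-code : ∀ t → T (codesForest 1 (code t))
codesForest-1-code t = subst T (sym (trans (cong (codesForest 1) (sym (++-identityʳ (code t)))) (codesForest-code t 0 []))) _

isTreeCode : ℕ → List ℕ → Bool
isTreeCode r w = codesForest 1 w ∧ (nonzeros w ≡ᵇ r)

-- u codes the root subtrees of a tree with n + 1 nodes, r of them internal,
-- whose root then has degree n ∸ sum u
isBranchesCode : ℕ → ℕ → List ℕ → Bool
isBranchesCode n r u = codesForest (n ∸ sum u) u ∧ (nonzeros u ≡ᵇ r ∸ 1)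

isMCode : ℕ → ℕ → ℕ → List ℕ → Bool
isMCode k n r w = isTreeCode r w ∧ ((length w ≡ᵇ suc n) ∧ bounded k w)

MTrees↔codes : ∀ k n r → MTrees k n r ↔ Σ (List ℕ) (T ∘ isMCode k n r)
MTrees↔codes k n r = Σ-↔ P-irrelevant T-irrelevant code decodeTree decodeTree-code
                         (code-decodeTree ∘ proj₁ ∘ ∧-elim ∘ proj₁ ∘ ∧-elim) P⇔Q
  where
  P-irrelevant : ∀ {t} → Irrelevant (size t ≡ suc n × internal t ≡ r × EveryDeg (_≤ k) t)
  P-irrelevant = ×-irrelevant ≡-irrelevant (×-irrelevant ≡-irrelevant (EveryDeg-irrelevant ≤-irrelevant))
  P⇔Q : ∀ t → (size t ≡ suc n × internal t ≡ r × EveryDeg (_≤ k) t) ⇔ T (isMCode k n r (code t))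
  P⇔Q t = mk⇔ to from
    where
    to : size t ≡ suc n × internal t ≡ r × EveryDeg (_≤ k) t → T (isMCode k n r (code t))
    to (size≡ , internal≡ , degrees) = ∧-intro {isTreeCode r (code t)} tree lb
      where
      tree : T (isTreeCode r (code t))
      tree = ∧-intro {codesForest 1 (code t)} (codesForest-1-code t) (Equivalence.from T-≡ᵇ⇔ (trans (nonzeros-code t) internal≡))
      lb : T ((length (code t) ≡ᵇ suc n) ∧ bounded k (code t))
      lb = ∧-intro {length (code t) ≡ᵇ suc n} (Equivalence.from T-≡ᵇ⇔ (trans (length-code t) size≡))
                                              (Equivalence.from T-bounded⇔ (EveryDeg⇒All-code degrees))
    from : T (isMCode k n r (code t)) → size t ≡ suc n × internal t ≡ r × EveryDeg (_≤ k) t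
    from q with ∧-elim {isTreeCode r (code t)} q
    ... | tree , lb with ∧-elim {codesForest 1 (code t)} tree | ∧-elim {length (code t) ≡ᵇ suc n} lb
    ... | _ , nonzeros≡ | length≡ , bounded =
      trans (sym (length-code t)) (Equivalence.to T-≡ᵇ⇔ length≡) ,
      trans (sym (nonzeros-code t)) (Equivalence.to T-≡ᵇ⇔ nonzeros≡) ,
      All-code⇒EveryDeg t (Equivalence.to T-bounded⇔ bounded)

isCCode : ℕ → ℕ → ℕ → List ℕ → Bool
isCCode k n r u = isBranchesCode n r u ∧ ((length u ≡ᵇ n) ∧ bounded k u)

-- a tree is its root together with the forest of its subtrees
CTrees↔codes : ∀ k n r → CTrees (suc k) (suc n) (suc r) ↔ Σ (List ℕ) (T ∘ isCCode k (suc n) (suc r))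
CTrees↔codes k n r = Σ-↔ P-irrelevant T-irrelevant branchesCode (node ∘ decode) decode-branches codes-decode P⇔Q
  where
  P : Tree → Set
  P t = size t ≡ suc (suc n) × internal t ≡ suc r × NonRootDeg (_< suc k) t
  P-irrelevant : ∀ {t} → Irrelevant (P t)
  P-irrelevant {node _} = ×-irrelevant ≡-irrelevant (×-irrelevant ≡-irrelevant (AllEveryDeg-irrelevant ≤-irrelevant))
  branchesCode : Tree → List ℕ
  branchesCode (node ts) = codes ts
  decode-branches : ∀ t → node (decode (branchesCode t)) ≡ t
  decode-branches (node ts) = cong node (decode-codes-[] ts)
  codes-decode : ∀ {u} → T (isCCode k (suc n) (suc r) u) → codes (decode u) ≡ u
  codes-decode {u} q = proj₂ (codesForest⇒decode (suc n ∸ sum u) u forest)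
    where forest = proj₁ (∧-elim {codesForest (suc n ∸ sum u) u} (proj₁ (∧-elim {isBranchesCode (suc n) (suc r) u} q)))
  P⇔Q : ∀ t → P t ⇔ T (isCCode k (suc n) (suc r) (branchesCode t))
  P⇔Q (node []) = mk⇔ (λ (size≡ , _) → ⊥-elim (0≢1+n (suc-injective size≡)))
                       (⊥-elim ∘ proj₂ ∘ ∧-elim {isBranchesCode (suc n) (suc r) []})
  P⇔Q (node ts@(_ ∷ _)) = mk⇔ to from
    where
    to : P (node ts) → T (isCCode k (suc n) (suc r) (codes ts))
    to (size≡ , internal≡ , degrees) = ∧-intro {isBranchesCode (suc n) (suc r) (codes ts)} branches lb
      where
      length≡ : length (codes ts) ≡ suc n
      length≡ = trans (length-codes ts) (suc-injective size≡)
      root≡ : suc n ∸ sum (codes ts) ≡ length ts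
      root≡ = trans (cong (_∸ sum (codes ts)) (trans (sym length≡) (sym (codesForest-sum (length ts) (codes ts) (codesForest-length-codes ts)))))
                    (m+n∸n≡m (length ts) (sum (codes ts)))
      branches : T (isBranchesCode (suc n) (suc r) (codes ts))
      branches = ∧-intro {codesForest (suc n ∸ sum (codes ts)) (codes ts)}
                   (subst (λ m → T (codesForest m (codes ts))) (sym root≡) (codesForest-length-codes ts))
                   (Equivalence.from T-≡ᵇ⇔ (trans (nonzeros-codes ts) (suc-injective internal≡)))
      lb : T ((length (codes ts) ≡ᵇ suc n) ∧ bounded k (codes ts))
      lb = ∧-intro {length (codes ts) ≡ᵇ suc n} (Equivalence.from T-≡ᵇ⇔ length≡)
                   (Equivalence.from T-bounded⇔ (All.map s≤s⁻¹ (AllEveryDeg⇒All-codes degrees)))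
    from : T (isCCode k (suc n) (suc r) (codes ts)) → P (node ts)
    from q with ∧-elim {isBranchesCode (suc n) (suc r) (codes ts)} q
    ... | branches , lb with ∧-elim {codesForest (suc n ∸ sum (codes ts)) (codes ts)} branches | ∧-elim {length (codes ts) ≡ᵇ suc n} lb
    ... | _ , nonzeros≡ | length≡ , bounded =
      cong suc (trans (sym (length-codes ts)) (Equivalence.to T-≡ᵇ⇔ length≡)) ,
      cong suc (trans (sym (nonzeros-codes ts)) (Equivalence.to T-≡ᵇ⇔ nonzeros≡)) ,
      All-codes⇒AllEveryDeg ts (All.map s≤s (Equivalence.to T-bounded⇔ bounded))

weaklyDecreasing≡decreasing? : ∀ {N} (v : Vec ℕ N) → weaklyDecreasing v ≡ decreasing? (toList v)
weaklyDecreasing≡decreasing? Vec.[]                = refl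
weaklyDecreasing≡decreasing? (x Vec.∷ Vec.[])      = refl
weaklyDecreasing≡decreasing? (x Vec.∷ y Vec.∷ ys)  = cong ((y ≤ᵇ x) ∧_) (weaklyDecreasing≡decreasing? (y Vec.∷ ys))

ℓ≡nonzeros : ∀ {N} (v : Vec ℕ N) → ℓ v ≡ nonzeros (toList v)
ℓ≡nonzeros Vec.[]       = refl
ℓ≡nonzeros (x Vec.∷ v) = cong (𝟙 (0 <ᵇ x) +_) (ℓ≡nonzeros v)

mult≡multiplicity : ∀ i {N} (v : Vec ℕ N) → mult i v ≡ multiplicity i (toList v)
mult≡multiplicity i Vec.[]       = refl
mult≡multiplicity i (x Vec.∷ v) = cong (𝟙 (x ≡ᵇ i) +_) (mult≡multiplicity i v)

-- Arrangements of a partition and the cycle lemma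

module Arrangements (k : ℕ) where

  fiberSum : ℕ → List ℕ → (List ℕ → ℕ) → ℕ
  fiberSum L λs g = ∑ (words k L) (λ w → 𝟙 (does (sort w ≟ᴸ λs)) * g w)

  arrangements : ℕ → List ℕ → ℕ
  arrangements L λs = fiberSum L λs (λ _ → 1)

  forestArrangements : ℕ → ℕ → List ℕ → ℕ
  forestArrangements L m λs = fiberSum L λs (𝟙 ∘ codesForest m)

  fiberSum-cong : ∀ L λs {g h : List ℕ → ℕ} → (∀ w → sort w ≡ λs → g w ≡ h w) → fiberSum L λs g ≡ fiberSum L λs h
  fiberSum-cong L λs {g} {h} g≗h = ∑-cong (words k L) pointwise
    where
    pointwise : ∀ w → 𝟙 (does (sort w ≟ᴸ λs)) * g w ≡ 𝟙 (does (sort w ≟ᴸ λs)) * h w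
    pointwise w with sort w ≟ᴸ λs
    ... | yes sorted = cong (1 *_) (g≗h w sorted)
    ... | no  _      = refl

  fiberSum-suc : ∀ L {λs} → Decreasing λs → ∀ g →
                 fiberSum (suc L) λs g ≡ ∑ (upTo (suc k)) (λ d → 𝟙 (d ∈ᵇ λs) * fiberSum L (remove d λs) (g ∘ (d ∷_)))
  fiberSum-suc L {λs} dec g = trans (∑-words-suc k L _) (∑-cong (upTo (suc k)) λ d → begin
    ∑ (words k L) (λ w → 𝟙 (does (insert d (sort w) ≟ᴸ λs)) * g (d ∷ w))
      ≡⟨ ∑-cong (words k L) (λ w → cong (_* g (d ∷ w)) (trans (cong 𝟙 (does-insert≟ d (sort w) dec)) (𝟙-∧ (d ∈ᵇ λs) _))) ⟩
    ∑ (words k L) (λ w → 𝟙 (d ∈ᵇ λs) * 𝟙 (does (sort w ≟ᴸ remove d λs)) * g (d ∷ w))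
      ≡⟨ ∑-cong (words k L) (λ w → *-assoc (𝟙 (d ∈ᵇ λs)) _ _) ⟩
    ∑ (words k L) (λ w → 𝟙 (d ∈ᵇ λs) * (𝟙 (does (sort w ≟ᴸ remove d λs)) * g (d ∷ w)))
      ≡⟨ *-distribˡ-∑ (𝟙 (d ∈ᵇ λs)) (words k L) _ ⟨
    𝟙 (d ∈ᵇ λs) * fiberSum L (remove d λs) (g ∘ (d ∷_))  ∎)
    where open ≡-Reasoning

  ∑-multiplicity : ∀ {λs} → All (_≤ k) λs → ∀ (h : ℕ → ℕ) → ∑ (upTo (suc k)) (λ d → multiplicity d λs * h d) ≡ ∑ λs h
  ∑-multiplicity []              h = ∑-zero (upTo (suc k))
  ∑-multiplicity {x ∷ xs} (x≤k ∷ xs≤k) h = begin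
    ∑ (upTo (suc k)) (λ d → (𝟙 (x ≡ᵇ d) + multiplicity d xs) * h d)
      ≡⟨ ∑-cong (upTo (suc k)) (λ d → *-distribʳ-+ (h d) (𝟙 (x ≡ᵇ d)) (multiplicity d xs)) ⟩
    ∑ (upTo (suc k)) (λ d → 𝟙 (x ≡ᵇ d) * h d + multiplicity d xs * h d)
      ≡⟨ ∑-+ (upTo (suc k)) (λ d → 𝟙 (x ≡ᵇ d) * h d) (λ d → multiplicity d xs * h d) ⟩
    ∑ (upTo (suc k)) (λ d → 𝟙 (x ≡ᵇ d) * h d) + ∑ (upTo (suc k)) (λ d → multiplicity d xs * h d)
      ≡⟨ cong₂ _+_ (∑-upTo-δ (suc k) x h) (∑-multiplicity xs≤k h) ⟩
    𝟙 (x <ᵇ suc k) * h x + ∑ xs h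
      ≡⟨ cong (λ b → 𝟙 b * h x + ∑ xs h) (Equivalence.to T-≡ (<⇒<ᵇ (s≤s x≤k))) ⟩
    h x + 0 + ∑ xs h
      ≡⟨ cong (_+ ∑ xs h) (+-identityʳ (h x)) ⟩
    h x + ∑ xs h  ∎
    where open ≡-Reasoning

  arrangements-suc : ∀ L {λs} → Decreasing λs →
                     arrangements (suc L) λs ≡ ∑ (upTo (suc k)) (λ d → 𝟙 (d ∈ᵇ λs) * arrangements L (remove d λs))
  arrangements-suc L dec = fiberSum-suc L dec (λ _ → 1)

  arrangements*prodFactMult : ∀ L b {λs} → Decreasing λs → All (_≤ k) λs → All (_< b) λs → length λs ≡ L →
                              arrangements L λs * prodFactMult b λs ≡ L !
  arrangements*prodFactMult zero    b {[]} _ _ _ _ = cong (1 *_) (prodFactMult-[] b)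
  arrangements*prodFactMult (suc L) b {λs} dec λs≤k λs<b len≡ = begin
    arrangements (suc L) λs * P λs
      ≡⟨ cong (_* P λs) (arrangements-suc L dec) ⟩
    ∑ (upTo (suc k)) (λ d → 𝟙 (d ∈ᵇ λs) * arrangements L (remove d λs)) * P λs
      ≡⟨ trans (*-comm _ (P λs)) (*-distribˡ-∑ (P λs) (upTo (suc k)) _) ⟩
    ∑ (upTo (suc k)) (λ d → P λs * (𝟙 (d ∈ᵇ λs) * arrangements L (remove d λs)))
      ≡⟨ ∑-cong (upTo (suc k)) term ⟩
    ∑ (upTo (suc k)) (λ d → multiplicity d λs * L !)
      ≡⟨ ∑-multiplicity λs≤k (λ _ → L !) ⟩
    ∑ λs (λ _ → L !)
      ≡⟨ ∑-const λs (L !) ⟩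
    length λs * L !
      ≡⟨ cong (_* L !) len≡ ⟩
    suc L !  ∎
    where
    open ≡-Reasoning
    P = prodFactMult b
    term : ∀ d → P λs * (𝟙 (d ∈ᵇ λs) * arrangements L (remove d λs)) ≡ multiplicity d λs * L !
    term d with d ∈ᵇ λs in d∈ᵇ
    ... | false rewrite ∉ᵇ⇒multiplicity≡0 d λs d∈ᵇ = *-zeroʳ (P λs)
    ... | true  = begin
      P λs * (1 * arrangements L μ)            ≡⟨ cong₂ _*_ (prodFactMult-remove b d dec d∈ (All.lookup λs<b d∈)) (*-identityˡ _) ⟩
      multiplicity d λs * P μ * arrangements L μ ≡⟨ *-assoc (multiplicity d λs) (P μ) _ ⟩
      multiplicity d λs * (P μ * arrangements L μ) ≡⟨ cong (multiplicity d λs *_) (*-comm (P μ) _) ⟩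
      multiplicity d λs * (arrangements L μ * P μ) ≡⟨ cong (multiplicity d λs *_) (arrangements*prodFactMult L b
                                                        (remove-decreasing d dec) (All-remove d λs≤k) (All-remove d λs<b)
                                                        (suc-injective (trans (sym (length-remove d dec d∈)) len≡))) ⟩
      multiplicity d λs * L !                  ∎
      where
      μ = remove d λs
      d∈ : d ∈ λs
      d∈ = ∈ᵇ⇒∈ d λs (subst T (sym d∈ᵇ) _)

  arrangements-remove : ∀ L d {λs} → Decreasing λs → All (_≤ k) λs → length λs ≡ suc L → d ∈ λs →
                        suc L * arrangements L (remove d λs) ≡ multiplicity d λs * arrangements (suc L) λs
  arrangements-remove L d {λs} dec λs≤k len≡ d∈ = *-cancelʳ-≡ _ _ (P μ) {{prodFact≢0 (applyUpTo (λ i → multiplicity i μ) (suc k))}} (begin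
    suc L * arrangements L μ * P μ                   ≡⟨ *-assoc (suc L) (arrangements L μ) (P μ) ⟩
    suc L * (arrangements L μ * P μ)                 ≡⟨ cong (suc L *_) (arrangements*prodFactMult L (suc k)
                                                          (remove-decreasing d dec) (All-remove d λs≤k) (All-remove d λs<suc-k)
                                                          (suc-injective (trans (sym (length-remove d dec d∈)) len≡))) ⟩
    suc L !                                          ≡⟨ arrangements*prodFactMult (suc L) (suc k) dec λs≤k λs<suc-k len≡ ⟨
    arrangements (suc L) λs * P λs                   ≡⟨ cong (arrangements (suc L) λs *_)
                                                            (prodFactMult-remove (suc k) d dec d∈ (All.lookup λs<suc-k d∈)) ⟩
    arrangements (suc L) λs * (multiplicity d λs * P μ) ≡⟨ *-assoc (arrangements (suc L) λs) _ _ ⟨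
    arrangements (suc L) λs * multiplicity d λs * P μ   ≡⟨ cong (_* P μ) (*-comm (arrangements (suc L) λs) _) ⟩
    multiplicity d λs * arrangements (suc L) λs * P μ   ∎)
    where
    open ≡-Reasoning
    P = prodFactMult (suc k)
    μ = remove d λs
    λs<suc-k : All (_< suc k) λs
    λs<suc-k = All.map s≤s λs≤k

  forestArrangements-suc : ∀ L m {λs} → Decreasing λs →
    forestArrangements (suc L) (suc m) λs ≡ ∑ (upTo (suc k)) (λ d → 𝟙 (d ∈ᵇ λs) * forestArrangements L (m + d) (remove d λs))
  forestArrangements-suc L m dec = fiberSum-suc L dec (𝟙 ∘ codesForest (suc m))

  forestArrangements-0 : ∀ L λs → forestArrangements (suc L) 0 λs ≡ 0
  forestArrangements-0 L λs = trans (∑-words-suc k L _)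
    (trans (∑-cong (upTo (suc k)) (λ d → trans (∑-cong (words k L) (λ w → *-zeroʳ (𝟙 (does (insert d (sort w) ≟ᴸ λs)))))
                                               (∑-zero (words k L))))
           (∑-zero (upTo (suc k))))

  ∈-words : ∀ {L w} → w ∈ words k L → T ((length w ≡ᵇ L) ∧ bounded k w)
  ∈-words {L} {w} w∈ with (length w ≡ᵇ L) ∧ bounded k w | occurrences-words k L w
  ... | true  | _  = _
  ... | false | o≡ = ⊥-elim (<-irrefl (sym o≡) (∈⇒occurrences-pos _≟ᴸ_ w∈))

  ∈-words⇒length : ∀ {L w} → w ∈ words k L → length w ≡ L
  ∈-words⇒length {L} {w} w∈ = ≡ᵇ⇒≡ (length w) L (proj₁ (Equivalence.to T-∧ (∈-words w∈)))

  forestArrangements-vanish : ∀ L m λs → m + sum λs ≢ L → forestArrangements L m λs ≡ 0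
  forestArrangements-vanish L m λs m+∑≢L = trans (∑-cong-∈ (words k L) pointwise) (∑-zero (words k L))
    where
    pointwise : ∀ {w} → w ∈ words k L → 𝟙 (does (sort w ≟ᴸ λs)) * 𝟙 (codesForest m w) ≡ 0
    pointwise {w} w∈ with sort w ≟ᴸ λs | codesForest m w in cf
    ... | no  _      | _     = refl
    ... | yes _      | false = refl
    ... | yes sorted | true  = ⊥-elim (m+∑≢L (begin
      m + sum λs       ≡⟨ cong (λ xs → m + sum xs) sorted ⟨
      m + sum (sort w) ≡⟨ cong (m +_) (sum-↭ (sort-↭ w)) ⟩
      m + sum w        ≡⟨ codesForest-sum m w (subst T (sym cf) _) ⟩
      length w         ≡⟨ ∈-words⇒length w∈ ⟩
      L                ∎))
      where open ≡-Reasoning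

  private
    cycle-lemma-step : ∀ L m →
      (∀ m′ {μ} → Decreasing μ → All (_≤ k) μ → length μ ≡ suc L → m′ + sum μ ≡ suc L →
         suc L * forestArrangements (suc L) m′ μ ≡ m′ * arrangements (suc L) μ) →
      ∀ {λs} → Decreasing λs → All (_≤ k) λs → length λs ≡ suc (suc L) → suc m + sum λs ≡ suc (suc L) →
      suc (suc L) * forestArrangements (suc (suc L)) (suc m) λs ≡ suc m * arrangements (suc (suc L)) λs
    cycle-lemma-step L m IH {λs} dec λs≤k len≡ m+∑≡ = *-cancelˡ-≡ _ _ N (begin
      N * (suc N * V (suc N) (suc m) λs)
        ≡⟨ cong (λ e → N * (suc N * e)) (forestArrangements-suc N m dec) ⟩
      N * (suc N * ∑ ds (λ d → 𝟙 (d ∈ᵇ λs) * V N (m + d) (remove d λs)))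
        ≡⟨ trans (cong (N *_) (*-distribˡ-∑ (suc N) ds (λ d → 𝟙 (d ∈ᵇ λs) * V N (m + d) (remove d λs))))
                 (*-distribˡ-∑ N ds (λ d → suc N * (𝟙 (d ∈ᵇ λs) * V N (m + d) (remove d λs)))) ⟩
      ∑ ds (λ d → N * (suc N * (𝟙 (d ∈ᵇ λs) * V N (m + d) (remove d λs))))
        ≡⟨ ∑-cong ds term ⟩
      ∑ ds (λ d → multiplicity d λs * ((m + d) * A))
        ≡⟨ ∑-multiplicity λs≤k (λ d → (m + d) * A) ⟩
      ∑ λs (λ d → (m + d) * A)
        ≡⟨ ∑-linear m λs A ⟩
      (m * length λs + sum λs) * A
        ≡⟨ cong (_* A) arithmetic ⟩
      N * suc m * A
        ≡⟨ *-assoc N (suc m) A ⟩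
      N * (suc m * A)  ∎)
      where
      open ≡-Reasoning
      N = suc L
      ds = upTo (suc k)
      V = forestArrangements
      A = arrangements (suc N) λs
      m+∑≡N : m + sum λs ≡ N
      m+∑≡N = suc-injective m+∑≡
      arithmetic : m * length λs + sum λs ≡ N * suc m
      arithmetic = begin
        m * length λs + sum λs  ≡⟨ cong (λ l → m * l + sum λs) len≡ ⟩
        m * suc N + sum λs      ≡⟨ cong (_+ sum λs) (*-suc m N) ⟩
        m + m * N + sum λs      ≡⟨ cong (_+ sum λs) (+-comm m (m * N)) ⟩
        m * N + m + sum λs      ≡⟨ +-assoc (m * N) m (sum λs) ⟩
        m * N + (m + sum λs)    ≡⟨ cong (m * N +_) m+∑≡N ⟩
        m * N + N               ≡⟨ cong₂ _+_ (*-comm m N) refl ⟩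
        N * m + N               ≡⟨ +-comm (N * m) N ⟩
        N + N * m               ≡⟨ *-suc N m ⟨
        N * suc m               ∎
      term : ∀ d → N * (suc N * (𝟙 (d ∈ᵇ λs) * V N (m + d) (remove d λs))) ≡ multiplicity d λs * ((m + d) * A)
      term d with d ∈ᵇ λs in d∈ᵇ
      ... | false rewrite ∉ᵇ⇒multiplicity≡0 d λs d∈ᵇ | *-zeroʳ (suc N) = *-zeroʳ N
      ... | true  = begin
        N * (suc N * (1 * V N (m + d) μ))     ≡⟨ cong (λ e → N * (suc N * e)) (*-identityˡ (V N (m + d) μ)) ⟩
        N * (suc N * V N (m + d) μ)           ≡⟨ *-exchangeˡ N (suc N) (V N (m + d) μ) ⟩
        suc N * (N * V N (m + d) μ)           ≡⟨ cong (suc N *_) (IH (m + d) (remove-decreasing d dec) (All-remove d λs≤k) len-μ m+d+∑μ) ⟩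
        suc N * ((m + d) * arrangements N μ)  ≡⟨ *-exchangeˡ (suc N) (m + d) (arrangements N μ) ⟩
        (m + d) * (suc N * arrangements N μ)  ≡⟨ cong ((m + d) *_) (arrangements-remove N d dec λs≤k len≡ d∈) ⟩
        (m + d) * (multiplicity d λs * A)     ≡⟨ *-exchangeˡ (m + d) (multiplicity d λs) A ⟩
        multiplicity d λs * ((m + d) * A)     ∎
        where
        μ = remove d λs
        d∈ : d ∈ λs
        d∈ = ∈ᵇ⇒∈ d λs (subst T (sym d∈ᵇ) _)
        len-μ : length μ ≡ N
        len-μ = suc-injective (trans (sym (length-remove d dec d∈)) len≡)
        m+d+∑μ : m + d + sum μ ≡ N
        m+d+∑μ = trans (+-assoc m d (sum μ)) (trans (cong (m +_) (sym (sum-remove d dec d∈))) m+∑≡N)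

  cycle-lemma : ∀ L m {λs} → Decreasing λs → All (_≤ k) λs → length λs ≡ L → m + sum λs ≡ L →
                L * forestArrangements L m λs ≡ m * arrangements L λs
  cycle-lemma zero          m       _ _ _ m+∑≡ rewrite m+n≡0⇒m≡0 m m+∑≡ = refl
  cycle-lemma (suc L)       zero    {λs} _ _ _ _ rewrite forestArrangements-0 L λs = *-zeroʳ (suc L)
  -- L = 1 is treated apart because the inductive step cancels a factor L.
  cycle-lemma (suc zero)    (suc m) {x ∷ []} dec _ _ m+∑≡
    with m+n≡0⇒m≡0 m (suc-injective m+∑≡) | m+n≡0⇒m≡0 x (m+n≡0⇒n≡0 m (suc-injective m+∑≡))
  ... | refl | refl = cong (1 *_) (trans (forestArrangements-suc 0 0 dec)
                                  (trans (∑-cong (upTo (suc k)) single-letter) (sym (arrangements-suc 0 dec))))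
    where
    single-letter : ∀ d → 𝟙 (d ∈ᵇ (0 ∷ [])) * forestArrangements 0 d (remove d (0 ∷ []))
                        ≡ 𝟙 (d ∈ᵇ (0 ∷ [])) * arrangements 0 (remove d (0 ∷ []))
    single-letter zero    = refl
    single-letter (suc d) = refl
  cycle-lemma (suc (suc L)) (suc m) dec λs≤k len≡ m+∑≡ = cycle-lemma-step L m (cycle-lemma (suc L)) dec λs≤k len≡ m+∑≡

  partitions : ℕ → List (List ℕ)
  partitions L = map toList (partitionsIn k L)

  occurrences-partitions : ∀ L λs →
    occurrences _≟ᴸ_ λs (partitions L) ≡ 𝟙 (decreasing? λs) * 𝟙 ((length λs ≡ᵇ L) ∧ bounded k λs)
  occurrences-partitions L λs = begin
    ∑ (partitions L) (λ μ → 𝟙 (does (λs ≟ᴸ μ)))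
      ≡⟨ ∑-map toList (partitionsIn k L) _ ⟩
    ∑ (filterᵇ weaklyDecreasing (boundedVecs k L)) (λ v → 𝟙 (does (λs ≟ᴸ toList v)))
      ≡⟨ ∑-filterᵇ weaklyDecreasing (boundedVecs k L) _ ⟩
    ∑ (boundedVecs k L) (λ v → 𝟙 (weaklyDecreasing v) * 𝟙 (does (λs ≟ᴸ toList v)))
      ≡⟨ ∑-cong (boundedVecs k L) pointwise ⟩
    ∑ (boundedVecs k L) (λ v → 𝟙 (decreasing? λs) * 𝟙 (does (λs ≟ᴸ toList v)))
      ≡⟨ *-distribˡ-∑ (𝟙 (decreasing? λs)) (boundedVecs k L) _ ⟨
    𝟙 (decreasing? λs) * ∑ (boundedVecs k L) (λ v → 𝟙 (does (λs ≟ᴸ toList v)))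
      ≡⟨ cong (𝟙 (decreasing? λs) *_) (trans (sym (∑-map toList (boundedVecs k L) _)) (occurrences-words k L λs)) ⟩
    𝟙 (decreasing? λs) * 𝟙 ((length λs ≡ᵇ L) ∧ bounded k λs)  ∎
    where
    open ≡-Reasoning
    pointwise : ∀ v → 𝟙 (weaklyDecreasing v) * 𝟙 (does (λs ≟ᴸ toList v)) ≡ 𝟙 (decreasing? λs) * 𝟙 (does (λs ≟ᴸ toList v))
    pointwise v with λs ≟ᴸ toList v
    ... | yes λs≡ = cong (λ b → 𝟙 b * 1) (trans (weaklyDecreasing≡decreasing? v) (cong decreasing? (sym λs≡)))
    ... | no  _    = trans (*-zeroʳ (𝟙 (weaklyDecreasing v))) (sym (*-zeroʳ (𝟙 (decreasing? λs))))

  ∈-partitions : ∀ {L λs} → λs ∈ partitions L → Decreasing λs × All (_≤ k) λs × length λs ≡ L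
  ∈-partitions {L} {λs} λs∈ with decreasing? λs in dec | (length λs ≡ᵇ L) ∧ bounded k λs in wb | occurrences-partitions L λs
  ... | true  | true  | _  = Equivalence.to (T-does⇔ (linked? _≥?_ λs)) (subst T (sym dec) _)
                           , Equivalence.to (T-does⇔ (all? (_≤? k) λs)) (proj₂ (Equivalence.to T-∧ (subst T (sym wb) _)))
                           , ≡ᵇ⇒≡ (length λs) L (proj₁ (Equivalence.to T-∧ (subst T (sym wb) _)))
  ... | true  | false | o≡ = ⊥-elim (<-irrefl (sym o≡) (∈⇒occurrences-pos _≟ᴸ_ λs∈))
  ... | false | _     | o≡ = ⊥-elim (<-irrefl (sym o≡) (∈⇒occurrences-pos _≟ᴸ_ λs∈))

  occurrences-sort : ∀ {L w} → w ∈ words k L → occurrences _≟ᴸ_ (sort w) (partitions L) ≡ 1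
  occurrences-sort {L} {w} w∈ = begin
    occurrences _≟ᴸ_ (sort w) (partitions L)
      ≡⟨ occurrences-partitions L (sort w) ⟩
    𝟙 (decreasing? (sort w)) * 𝟙 ((length (sort w) ≡ᵇ L) ∧ bounded k (sort w))
      ≡⟨ cong₂ (λ a b → 𝟙 a * 𝟙 b) (dec-true (linked? _≥?_ (sort w)) (sort-↗ w))
               (cong₂ (λ l b → (l ≡ᵇ L) ∧ b) (↭-length (sort-↭ w)) (bounded-↭ k (sort-↭ w))) ⟩
    1 * 𝟙 ((length w ≡ᵇ L) ∧ bounded k w)
      ≡⟨ *-identityˡ _ ⟩
    𝟙 ((length w ≡ᵇ L) ∧ bounded k w)
      ≡⟨ cong 𝟙 (Equivalence.to T-≡ (∈-words w∈)) ⟩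
    1  ∎
    where open ≡-Reasoning

  ∑-fibers : ∀ L (g : List ℕ → ℕ) → ∑ (words k L) g ≡ ∑ (partitions L) (λ λs → fiberSum L λs g)
  ∑-fibers L g = sym (begin
    ∑ (partitions L) (λ λs → ∑ (words k L) (λ w → 𝟙 (does (sort w ≟ᴸ λs)) * g w))
      ≡⟨ ∑-comm (partitions L) (words k L) _ ⟩
    ∑ (words k L) (λ w → ∑ (partitions L) (λ λs → 𝟙 (does (sort w ≟ᴸ λs)) * g w))
      ≡⟨ ∑-cong-∈ (words k L) (λ {w} w∈ → begin
           ∑ (partitions L) (λ λs → 𝟙 (does (sort w ≟ᴸ λs)) * g w)
             ≡⟨ ∑-cong (partitions L) (λ λs → *-comm _ (g w)) ⟩
           ∑ (partitions L) (λ λs → g w * 𝟙 (does (sort w ≟ᴸ λs)))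
             ≡⟨ *-distribˡ-∑ (g w) (partitions L) _ ⟨
           g w * occurrences _≟ᴸ_ (sort w) (partitions L)
             ≡⟨ cong (g w *_) (occurrences-sort w∈) ⟩
           g w * 1
             ≡⟨ *-identityʳ (g w) ⟩
           g w  ∎) ⟩
    ∑ (words k L) g  ∎)
    where open ≡-Reasoning

  fiberSum-*ˡ : ∀ L λs c (g : List ℕ → ℕ) → fiberSum L λs (λ w → c * g w) ≡ c * fiberSum L λs g
  fiberSum-*ˡ L λs c g = trans (∑-cong (words k L) (λ w → *-exchangeˡ (𝟙 (does (sort w ≟ᴸ λs))) c (g w)))
                               (sym (*-distribˡ-∑ c (words k L) _))

  -- on a fiber, sum and number of nonzero letters are those of λs
  fiberSum-codesForest : ∀ L λs (h : ℕ → ℕ) c →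
    fiberSum L λs (λ w → 𝟙 (codesForest (h (sum w)) w ∧ (nonzeros w ≡ᵇ c)))
      ≡ 𝟙 (nonzeros λs ≡ᵇ c) * forestArrangements L (h (sum λs)) λs
  fiberSum-codesForest L λs h c =
    trans (fiberSum-cong L λs pointwise) (fiberSum-*ˡ L λs (𝟙 (nonzeros λs ≡ᵇ c)) (𝟙 ∘ codesForest (h (sum λs))))
    where
    pointwise : ∀ w → sort w ≡ λs →
                𝟙 (codesForest (h (sum w)) w ∧ (nonzeros w ≡ᵇ c)) ≡ 𝟙 (nonzeros λs ≡ᵇ c) * 𝟙 (codesForest (h (sum λs)) w)
    pointwise w refl = begin
      𝟙 (codesForest (h (sum w)) w ∧ (nonzeros w ≡ᵇ c))
        ≡⟨ cong₂ (λ s z → 𝟙 (codesForest (h s) w ∧ (z ≡ᵇ c))) (sum-↭ (sort-↭ w)) (∑-↭ _ (sort-↭ w)) ⟨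
      𝟙 (codesForest (h (sum (sort w))) w ∧ (nonzeros (sort w) ≡ᵇ c))
        ≡⟨ 𝟙-∧ (codesForest (h (sum (sort w))) w) _ ⟩
      𝟙 (codesForest (h (sum (sort w))) w) * 𝟙 (nonzeros (sort w) ≡ᵇ c)
        ≡⟨ *-comm (𝟙 (codesForest (h (sum (sort w))) w)) _ ⟩
      𝟙 (nonzeros (sort w) ≡ᵇ c) * 𝟙 (codesForest (h (sum (sort w))) w)  ∎
      where open ≡-Reasoning

  mλ≡arrangements : ∀ {N} (v : Vec ℕ N) → Decreasing (toList v) → All (_≤ k) (toList v) →
                    mλ v ≡ arrangements N (toList v)
  mλ≡arrangements {N} v dec v≤k = begin
    mλ v
      ≡⟨ /-congʳ {{prodFact≢0 ms}} {{prodFact≢0 ms′}} ms!≡ms′! ⟩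
    (N ! / P) {{prodFact≢0 ms′}}
      ≡⟨ /-congˡ {{prodFact≢0 ms′}} (sym (arrangements*prodFactMult N b dec v≤k
                                          (All.map s≤s (All-≤-sum (toList v))) (length-toList v))) ⟩
    (A * P / P) {{prodFact≢0 ms′}}
      ≡⟨ m*n/n≡m A P {{prodFact≢0 ms′}} ⟩
    A  ∎
    where
    open ≡-Reasoning
    b = suc ∣ v ∣ₚ
    ms = map (λ i → mult i v) (upTo b)
    ms′ = applyUpTo (λ i → multiplicity i (toList v)) b
    P = prodFactMult b (toList v)
    A = arrangements N (toList v)
    ms!≡ms′! : prodFact ms ≡ prodFact ms′
    ms!≡ms′! = trans (cong prodFact (map-upTo (λ i → mult i v) b)) (prodFact-cong b (λ i → mult≡multiplicity i v))

  ∈-partitionsIn : ∀ {L v} → v ∈ partitionsIn k L → Decreasing (toList v) × All (_≤ k) (toList v) × length (toList v) ≡ L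
  ∈-partitionsIn v∈ = ∈-partitions (∈-map⁺ toList v∈)

  ∑-partitions : ∀ L (g : List ℕ → ℕ) (F : Vec ℕ L → ℕ) →
    (∀ v → Decreasing (toList v) → All (_≤ k) (toList v) → length (toList v) ≡ L → L * fiberSum L (toList v) g ≡ F v) →
    L * ∑ (words k L) g ≡ ∑ (partitionsIn k L) F
  ∑-partitions L g F fiber≡ = begin
    L * ∑ (words k L) g
      ≡⟨ cong (L *_) (∑-fibers L g) ⟩
    L * ∑ (partitions L) (λ λs → fiberSum L λs g)
      ≡⟨ *-distribˡ-∑ L (partitions L) _ ⟩
    ∑ (partitions L) (λ λs → L * fiberSum L λs g)
      ≡⟨ ∑-map toList (partitionsIn k L) _ ⟩
    ∑ (partitionsIn k L) (λ v → L * fiberSum L (toList v) g)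
      ≡⟨ ∑-cong-∈ (partitionsIn k L) (λ {v} v∈ → let dec , ≤k , len = ∈-partitionsIn v∈ in fiber≡ v dec ≤k len) ⟩
    ∑ (partitionsIn k L) F  ∎
    where open ≡-Reasoning

  treeCodes≡SumM : ∀ n r → suc n * ∑ (words k (suc n)) (𝟙 ∘ isTreeCode r) ≡ SumM k n r
  treeCodes≡SumM n r = ∑-partitions (suc n) _ _ fiber
    where
    open ≡-Reasoning
    trees : ∀ {λs} → Decreasing λs → All (_≤ k) λs → length λs ≡ suc n →
            suc n * forestArrangements (suc n) 1 λs ≡ 𝟙 (sum λs ≡ᵇ n) * arrangements (suc n) λs
    trees {λs} dec ≤k len with sum λs ≡ᵇ n in ∑≡ᵇn
    ... | true  = cycle-lemma (suc n) 1 dec ≤k len (cong suc (≡ᵇ⇒≡ (sum λs) n (subst T (sym ∑≡ᵇn) _)))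
    ... | false rewrite forestArrangements-vanish (suc n) 1 λs (λ 1+∑≡ → subst T ∑≡ᵇn (≡⇒≡ᵇ (sum λs) n (suc-injective 1+∑≡))) =
      *-zeroʳ (suc n)
    fiber : ∀ v → Decreasing (toList v) → All (_≤ k) (toList v) → length (toList v) ≡ suc n →
            suc n * fiberSum (suc n) (toList v) (𝟙 ∘ isTreeCode r) ≡ (if (∣ v ∣ₚ ≡ᵇ n) ∧ (ℓ v ≡ᵇ r) then mλ v else 0)
    fiber v dec ≤k len = begin
      suc n * fiberSum (suc n) λs (𝟙 ∘ isTreeCode r)
        ≡⟨ cong (suc n *_) (fiberSum-codesForest (suc n) λs (λ _ → 1) r) ⟩
      suc n * (𝟙 (nonzeros λs ≡ᵇ r) * forestArrangements (suc n) 1 λs)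
        ≡⟨ *-exchangeˡ (suc n) (𝟙 (nonzeros λs ≡ᵇ r)) _ ⟩
      𝟙 (nonzeros λs ≡ᵇ r) * (suc n * forestArrangements (suc n) 1 λs)
        ≡⟨ cong (𝟙 (nonzeros λs ≡ᵇ r) *_) (trees dec ≤k len) ⟩
      𝟙 (nonzeros λs ≡ᵇ r) * (𝟙 (sum λs ≡ᵇ n) * arrangements (suc n) λs)
        ≡⟨ cong₂ (λ b a → 𝟙 b * (𝟙 (sum λs ≡ᵇ n) * a)) (cong (_≡ᵇ r) (ℓ≡nonzeros v)) (mλ≡arrangements v dec ≤k) ⟨
      𝟙 (ℓ v ≡ᵇ r) * (𝟙 (sum λs ≡ᵇ n) * mλ v)
        ≡⟨ if∧≡𝟙*𝟙* (sum λs ≡ᵇ n) (ℓ v ≡ᵇ r) (mλ v) ⟨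
      (if (sum λs ≡ᵇ n) ∧ (ℓ v ≡ᵇ r) then mλ v else 0)  ∎
        where λs = toList v

  branchesCodes≡SumC : ∀ n r → n * ∑ (words k n) (𝟙 ∘ isBranchesCode n r) ≡ SumC k n r
  branchesCodes≡SumC n r = ∑-partitions n _ _ fiber
    where
    open ≡-Reasoning
    forests : ∀ {λs} → Decreasing λs → All (_≤ k) λs → length λs ≡ n →
              n * forestArrangements n (n ∸ sum λs) λs ≡ (n ∸ sum λs) * arrangements n λs
    forests {λs} dec ≤k len with sum λs ≤? n
    ... | yes ∑≤n = cycle-lemma n (n ∸ sum λs) dec ≤k len (m∸n+n≡m ∑≤n)
    ... | no  ∑≰n rewrite m≤n⇒m∸n≡0 (<⇒≤ (≰⇒> ∑≰n))
                  | forestArrangements-vanish n 0 λs (λ ∑≡n → ∑≰n (≤-reflexive ∑≡n)) = *-zeroʳ n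
    fiber : ∀ v → Decreasing (toList v) → All (_≤ k) (toList v) → length (toList v) ≡ n →
            n * fiberSum n (toList v) (𝟙 ∘ isBranchesCode n r)
              ≡ (if (∣ v ∣ₚ <ᵇ n) ∧ (ℓ v ≡ᵇ r ∸ 1) then (n ∸ ∣ v ∣ₚ) * mλ v else 0)
    fiber v dec ≤k len = begin
      n * fiberSum n λs (𝟙 ∘ isBranchesCode n r)
        ≡⟨ cong (n *_) (fiberSum-codesForest n λs (n ∸_) (r ∸ 1)) ⟩
      n * (𝟙 (nonzeros λs ≡ᵇ r ∸ 1) * forestArrangements n (n ∸ sum λs) λs)
        ≡⟨ *-exchangeˡ n (𝟙 (nonzeros λs ≡ᵇ r ∸ 1)) _ ⟩
      𝟙 (nonzeros λs ≡ᵇ r ∸ 1) * (n * forestArrangements n (n ∸ sum λs) λs)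
        ≡⟨ cong (𝟙 (nonzeros λs ≡ᵇ r ∸ 1) *_) (forests dec ≤k len) ⟩
      𝟙 (nonzeros λs ≡ᵇ r ∸ 1) * ((n ∸ sum λs) * arrangements n λs)
        ≡⟨ cong₂ (λ b a → 𝟙 b * ((n ∸ sum λs) * a)) (cong (_≡ᵇ r ∸ 1) (ℓ≡nonzeros v)) (mλ≡arrangements v dec ≤k) ⟨
      𝟙 (ℓ v ≡ᵇ r ∸ 1) * ((n ∸ sum λs) * mλ v)
        ≡⟨ cong (𝟙 (ℓ v ≡ᵇ r ∸ 1) *_) (∸*≡𝟙<ᵇ* n (sum λs) (mλ v)) ⟩
      𝟙 (ℓ v ≡ᵇ r ∸ 1) * (𝟙 (sum λs <ᵇ n) * ((n ∸ sum λs) * mλ v))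
        ≡⟨ if∧≡𝟙*𝟙* (sum λs <ᵇ n) (ℓ v ≡ᵇ r ∸ 1) _ ⟨
      (if (sum λs <ᵇ n) ∧ (ℓ v ≡ᵇ r ∸ 1) then (n ∸ sum λs) * mλ v else 0)  ∎
        where λs = toList v

MTrees-count : ∀ k n r → ∃[ N ] ((MTrees k n r ↔ Fin N) × suc n * N ≡ SumM k n r)
MTrees-count k n r =
  length treeCodes ,
  Enumerates⇒↔Fin _≟ᴸ_ {isMCode k n r} {treeCodes} (Enumerates-filter-words k (suc n) (isTreeCode r)) ↔-∘ MTrees↔codes k n r ,
  trans (cong (suc n *_) (length-filterᵇ (isTreeCode r) (words k (suc n)))) (Arrangements.treeCodes≡SumM k n r)
  where treeCodes = filterᵇ (isTreeCode r) (words k (suc n))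

CTrees-count : ∀ k n r → ∃[ N ] ((CTrees (suc k) (suc n) (suc r) ↔ Fin N) × suc n * N ≡ SumC k (suc n) (suc r))
CTrees-count k n r =
  length branchesCodes ,
  Enumerates⇒↔Fin _≟ᴸ_ {isCCode k (suc n) (suc r)} {branchesCodes} (Enumerates-filter-words k (suc n) (isBranchesCode (suc n) (suc r)))
    ↔-∘ CTrees↔codes k n r ,
  trans (cong (suc n *_) (length-filterᵇ (isBranchesCode (suc n) (suc r)) (words k (suc n)))) (Arrangements.branchesCodes≡SumC k (suc n) (suc r))
  where branchesCodes = filterᵇ (isBranchesCode (suc n) (suc r)) (words k (suc n))

proposition6p3 : ((k n r : ℕ) → 1 ≤ k → r ≤ n →
    ∃[ N ] ((MTrees k n r ↔ Fin N) × suc n * N ≡ SumM k n r))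
    ×
    ((k n r : ℕ) → 1 ≤ n → 1 ≤ r → r ≤ n →
    ∃[ N ] ((CTrees (suc k) n r ↔ Fin N) × n * N ≡ SumC k n r))
proposition6p3 = (λ k n r _ _ → MTrees-count k n r) , λ { k (suc n) (suc r) _ _ _ → CTrees-count k n r }
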